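{- For every integer $n\geq 1$, $R(Q_2,Q_n)\leq 2n+2$.
   Context: $Q_N$ denotes the Boolean lattice of dimension $N$: the power set $2^{[N]}$ ordered by inclusion. For posets $P,P'$, an embedding of $P$ into $P'$ is an injective map $f$ with $x\leq y$ in $P$ iff $f(x)\leq f(y)$ in $P'$; its image is a copy of $P$. For finite posets $P,P'$, $R(P,P')$ is the smallest $N$ such that every red/blue coloring of the elements of $Q_N$ contains a copy of $P$ with all elements red or a copy of $P'$ with all elements blue. -}

module Defs where

open import Data.Nat using (ℕ; _≤_)
open import Data.Bool using (Bool; true; false)
open import Data.Sum using (_⊎_)
open import Data.Fin.Subset using (Subset; _⊆_)
open import Data.Product using (Σ; _×_; ∃-syntax)
open import Relation.Binary.PropositionalEquality using (_≡_)

Q : ℕ → Set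
Q N = Subset N

record Embedding (m N : ℕ) : Set where
  field
    map       : Q m → Q N
    injective : ∀ x y → map x ≡ map y → x ≡ y
    mono      : ∀ x y → x ⊆ y → map x ⊆ map y
    reflect   : ∀ x y → map x ⊆ map y → x ⊆ y

-- A red/blue colouring of Q_N: true = red, false = blue.
Colouring : ℕ → Set
Colouring N = Q N → Bool

MonoCopy : (N m : ℕ) → Colouring N → Bool → Set
MonoCopy N m c b = Σ (Embedding m N) λ f → ∀ x → c (Embedding.map f x) ≡ b

RamseyProp : ℕ → ℕ → ℕ → Set
RamseyProp a b N = (c : Colouring N) → MonoCopy N a c true ⊎ MonoCopy N b c false

R≤ : ℕ → ℕ → ℕ → Set
R≤ a b M = ∃[ N ] (N ≤ M × RamseyProp a b N)

-- Write Q_{2n+2} as the set of x ++ (a ∷ b ∷ y) with x, y ∈ Q_n. Call x ∈ Q_n low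
-- if t ++ ⊥ is red for some t ⊆ x. Low sets form an up-set, so adding all the last
-- n + 2 coordinates exactly to the low x embeds Q_n. If this copy is not blue, a red
-- element of it must be x ++ ⊤ with x low, witnessed by a red t ++ ⊥, t ⊆ x. The two
-- copies y ↦ t ++ (1 ∷ 0 ∷ y) and y ↦ t ++ (0 ∷ 1 ∷ y) of Q_n are then blue or have
-- red elements p and q, which are incomparable and lie between t ++ ⊥ and x ++ ⊤:
-- a red Q_2.
module Submission where

open import Defs
open import Data.Nat using (ℕ; _≤_; _+_; _*_; suc)
open import Data.Nat.Properties using (≤-reflexive)
open import Data.Nat.Tactic.RingSolver using (solve-∀)
open import Data.Bool using (Bool; true; false)
open import Data.Bool.Properties using (¬-not) renaming (_≟_ to _≟ᵇ_)
open import Data.Vec using ([]; _∷_; _++_; replicate; here)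
open import Data.Fin.Subset using (Subset; _⊆_; ⊥; ⊤; inside; outside)
open import Data.Fin.Subset.Properties
  using (drop-∷-⊆; s⊆s; out⊆; ⊆-refl; ⊆-trans; ⊆-antisym; ⊆-reflexive; ⊥⊆; ⊆⊤; _⊆?_; anySubset?)
open import Data.Sum using (_⊎_; inj₁; inj₂)
open import Data.Product using (_×_; _,_; ∃-syntax)
open import Data.Empty using (⊥-elim)
open import Function using (_∘_)
open import Relation.Nullary using (¬_; Dec; yes; no; does; _×-dec_)
open import Relation.Binary.PropositionalEquality using (_≡_; sym)

private
  variable
    k m N : ℕ

inside⊈outside : {p q : Subset k} → ¬ (inside ∷ p ⊆ outside ∷ q)
inside⊈outside h with h here
... | ()

++-mono-⊆ : {p p′ : Subset k} {q q′ : Subset m} → p ⊆ p′ → q ⊆ q′ → p ++ q ⊆ p′ ++ q′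
++-mono-⊆ {p = []}          {[]}           _ q⊆q′ = q⊆q′
++-mono-⊆ {p = outside ∷ p} {_ ∷ p′}       h q⊆q′ = out⊆ (++-mono-⊆ (drop-∷-⊆ h) q⊆q′)
++-mono-⊆ {p = inside ∷ p}  {inside ∷ p′}  h q⊆q′ = s⊆s (++-mono-⊆ (drop-∷-⊆ h) q⊆q′)
++-mono-⊆ {p = inside ∷ p}  {outside ∷ p′} h q⊆q′ = ⊥-elim (inside⊈outside h)

⊆-++ˡ⁻ : (p p′ : Subset k) {q q′ : Subset m} → p ++ q ⊆ p′ ++ q′ → p ⊆ p′
⊆-++ˡ⁻ []            []             _ = ⊆-refl
⊆-++ˡ⁻ (outside ∷ p) (_ ∷ p′)       h = out⊆ (⊆-++ˡ⁻ p p′ (drop-∷-⊆ h))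
⊆-++ˡ⁻ (inside ∷ p)  (inside ∷ p′)  h = s⊆s (⊆-++ˡ⁻ p p′ (drop-∷-⊆ h))
⊆-++ˡ⁻ (inside ∷ p)  (outside ∷ p′) h = ⊥-elim (inside⊈outside h)

⊆-++ʳ⁻ : (p p′ : Subset k) {q q′ : Subset m} → p ++ q ⊆ p′ ++ q′ → q ⊆ q′
⊆-++ʳ⁻ []      []        h = h
⊆-++ʳ⁻ (_ ∷ p) (_ ∷ p′) h = ⊆-++ʳ⁻ p p′ (drop-∷-⊆ h)

fromOrderEmbedding : (f : Q m → Q N) → (∀ x y → x ⊆ y → f x ⊆ f y) →
                     (∀ x y → f x ⊆ f y → x ⊆ y) → Embedding m N
fromOrderEmbedding f mono reflect = record
  { map       = f
  ; injective = λ x y fx≡fy →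
      ⊆-antisym (reflect x y (⊆-reflexive fx≡fy)) (reflect y x (⊆-reflexive (sym fx≡fy)))
  ; mono      = mono
  ; reflect   = reflect
  }

_∘ᴱ_ : Embedding m N → Embedding k m → Embedding k N
g ∘ᴱ f = fromOrderEmbedding (G.map ∘ F.map)
  (λ x y x⊆y → G.mono _ _ (F.mono x y x⊆y))
  (λ x y gfx⊆gfy → F.reflect x y (G.reflect _ _ gfx⊆gfy))
  where module G = Embedding g; module F = Embedding f

prefixEmbedding : Subset k → Embedding m (k + m)
prefixEmbedding p = fromOrderEmbedding (p ++_) (λ _ _ → ++-mono-⊆ ⊆-refl) (λ _ _ → ⊆-++ʳ⁻ p p)

consEmbedding : Bool → Embedding m (suc m)
consEmbedding s = fromOrderEmbedding (s ∷_) (λ _ _ → s⊆s) (λ _ _ → drop-∷-⊆)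

graphEmbedding : (g : Q k → Q m) → (∀ x y → x ⊆ y → g x ⊆ g y) → Embedding k (k + m)
graphEmbedding g g-mono = fromOrderEmbedding (λ x → x ++ g x)
  (λ x y x⊆y → ++-mono-⊆ x⊆y (g-mono x y x⊆y)) (λ x y → ⊆-++ˡ⁻ x y)

blueCopyOrRedPoint : (c : Colouring N) (e : Embedding m N) →
                     MonoCopy N m c false ⊎ ∃[ y ] c (Embedding.map e y) ≡ true
blueCopyOrRedPoint c e with anySubset? (λ y → c (Embedding.map e y) ≟ᵇ true)
... | yes red  = inj₂ red
... | no ¬red  = inj₁ (e , λ y → ¬-not (λ red → ¬red (y , red)))

diamond : Q N → Q N → Q N → Q N → Q 2 → Q N
diamond u p q v (outside ∷ outside ∷ []) = u
diamond u p q v (inside  ∷ outside ∷ []) = p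
diamond u p q v (outside ∷ inside  ∷ []) = q
diamond u p q v (inside  ∷ inside  ∷ []) = v

diamond-all : ∀ {ℓ} (P : Q N → Set ℓ) {u p q v : Q N} → P u → P p → P q → P v →
              ∀ x → P (diamond u p q v x)
diamond-all P Pu Pp Pq Pv (outside ∷ outside ∷ []) = Pu
diamond-all P Pu Pp Pq Pv (inside  ∷ outside ∷ []) = Pp
diamond-all P Pu Pp Pq Pv (outside ∷ inside  ∷ []) = Pq
diamond-all P Pu Pp Pq Pv (inside  ∷ inside  ∷ []) = Pv

module _ {u p q v : Q N} (u⊆p : u ⊆ p) (u⊆q : u ⊆ q) (p⊆v : p ⊆ v) (q⊆v : q ⊆ v)
         (p⊈q : ¬ p ⊆ q) (q⊈p : ¬ q ⊆ p) where

  diamondEmbedding : Embedding 2 N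
  diamondEmbedding = fromOrderEmbedding (diamond u p q v) mono reflect
    where
    mono : ∀ x y → x ⊆ y → diamond u p q v x ⊆ diamond u p q v y
    mono (outside ∷ outside ∷ []) y _ = diamond-all (u ⊆_) ⊆-refl u⊆p u⊆q (⊆-trans u⊆p p⊆v) y
    mono x (inside ∷ inside ∷ []) _ = diamond-all (_⊆ v) (⊆-trans u⊆p p⊆v) p⊆v q⊆v ⊆-refl x
    mono (inside ∷ outside ∷ []) (inside ∷ outside ∷ []) _ = ⊆-refl
    mono (outside ∷ inside ∷ []) (outside ∷ inside ∷ []) _ = ⊆-refl
    mono (inside ∷ _ ∷ []) (outside ∷ _ ∷ []) x⊆y = ⊥-elim (inside⊈outside x⊆y)
    mono (_ ∷ inside ∷ []) (_ ∷ outside ∷ []) x⊆y = ⊥-elim (inside⊈outside (drop-∷-⊆ x⊆y))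

    reflect : ∀ x y → diamond u p q v x ⊆ diamond u p q v y → x ⊆ y
    reflect (outside ∷ outside ∷ []) _ _ = ⊥⊆
    reflect _ (inside ∷ inside ∷ []) _ = ⊆⊤
    reflect (inside ∷ outside ∷ []) (inside ∷ outside ∷ []) _ = ⊆-refl
    reflect (outside ∷ inside ∷ []) (outside ∷ inside ∷ []) _ = ⊆-refl
    reflect (inside ∷ outside ∷ []) (outside ∷ outside ∷ []) p⊆u = ⊥-elim (p⊈q (⊆-trans p⊆u u⊆q))
    reflect (inside ∷ outside ∷ []) (outside ∷ inside ∷ [])  p⊆q = ⊥-elim (p⊈q p⊆q)
    reflect (outside ∷ inside ∷ []) (outside ∷ outside ∷ []) q⊆u = ⊥-elim (q⊈p (⊆-trans q⊆u u⊆p))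
    reflect (outside ∷ inside ∷ []) (inside ∷ outside ∷ [])  q⊆p = ⊥-elim (q⊈p q⊆p)
    reflect (inside ∷ inside ∷ [])  (outside ∷ outside ∷ []) v⊆u =
      ⊥-elim (q⊈p (⊆-trans q⊆v (⊆-trans v⊆u u⊆p)))
    reflect (inside ∷ inside ∷ [])  (inside ∷ outside ∷ [])  v⊆p = ⊥-elim (q⊈p (⊆-trans q⊆v v⊆p))
    reflect (inside ∷ inside ∷ [])  (outside ∷ inside ∷ [])  v⊆q = ⊥-elim (p⊈q (⊆-trans p⊆v v⊆q))

module _ (n : ℕ) (c : Colouring (n + (2 + n))) where

  private
    Red : Q (n + (2 + n)) → Set
    Red x = c x ≡ true

  Low : Q n → Set
  Low x = ∃[ t ] t ⊆ x × Red (t ++ ⊥)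

  low? : ∀ x → Dec (Low x)
  low? x = anySubset? (λ t → t ⊆? x ×-dec c (t ++ ⊥) ≟ᵇ true)

  Low-upward : ∀ {x y} → x ⊆ y → Low x → Low y
  Low-upward x⊆y (t , t⊆x , red) = t , ⊆-trans t⊆x x⊆y , red

  level : Q n → Q (2 + n)
  level x = replicate (2 + n) (does (low? x))

  level-mono : ∀ x y → x ⊆ y → level x ⊆ level y
  level-mono x y x⊆y with low? x | low? y
  ... | no _     | _        = ⊥⊆
  ... | yes _    | yes _    = ⊆-refl
  ... | yes lowx | no ¬lowy = ⊥-elim (¬lowy (Low-upward x⊆y lowx))

  redLevel : ∀ {x} → Red (x ++ level x) → ∃[ t ] t ⊆ x × Red (t ++ ⊥) × Red (x ++ ⊤)
  redLevel {x} red with low? x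
  ... | yes (t , t⊆x , redt) = t , t⊆x , redt , red
  ... | no ¬low              = ⊥-elim (¬low (x , ⊆-refl , red))

  redQ₂OrBlueQₙAbove : ∀ {t x} → t ⊆ x → Red (t ++ ⊥) → Red (x ++ ⊤) →
                       MonoCopy _ 2 c true ⊎ MonoCopy _ n c false
  redQ₂OrBlueQₙAbove {t} {x} t⊆x redu redv
    with blueCopyOrRedPoint c (prefixEmbedding t ∘ᴱ (consEmbedding inside ∘ᴱ consEmbedding outside))
       | blueCopyOrRedPoint c (prefixEmbedding t ∘ᴱ (consEmbedding outside ∘ᴱ consEmbedding inside))
  ... | inj₁ blue       | _               = inj₂ blue
  ... | inj₂ _          | inj₁ blue       = inj₂ blue
  ... | inj₂ (y , redp) | inj₂ (y′ , redq) =
    inj₁ (diamondEmbedding u⊆p u⊆q p⊆v q⊆v p⊈q q⊈p , diamond-all Red redu redp redq redv)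
    where
    p q : Q (n + (2 + n))
    p = t ++ (inside ∷ outside ∷ y)
    q = t ++ (outside ∷ inside ∷ y′)
    u⊆p : t ++ ⊥ ⊆ p
    u⊆p = ++-mono-⊆ {p = t} ⊆-refl ⊥⊆
    u⊆q : t ++ ⊥ ⊆ q
    u⊆q = ++-mono-⊆ {p = t} ⊆-refl ⊥⊆
    p⊆v : p ⊆ x ++ ⊤
    p⊆v = ++-mono-⊆ t⊆x ⊆⊤
    q⊆v : q ⊆ x ++ ⊤
    q⊆v = ++-mono-⊆ t⊆x ⊆⊤
    p⊈q : ¬ p ⊆ q
    p⊈q h = inside⊈outside (⊆-++ʳ⁻ t t h)
    q⊈p : ¬ q ⊆ p
    q⊈p h = inside⊈outside (drop-∷-⊆ (⊆-++ʳ⁻ t t h))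

  redQ₂OrBlueQₙ : MonoCopy _ 2 c true ⊎ MonoCopy _ n c false
  redQ₂OrBlueQₙ with blueCopyOrRedPoint c (graphEmbedding level level-mono)
  ... | inj₁ blue       = inj₂ blue
  ... | inj₂ (_ , red) with redLevel red
  ...   | _ , t⊆x , redu , redv = redQ₂OrBlueQₙAbove t⊆x redu redv

n+[2+n]≡2*n+2 : ∀ n → n + (2 + n) ≡ 2 * n + 2
n+[2+n]≡2*n+2 = solve-∀

-- The bound also holds for n = 0.
theorem1 : (n : ℕ) → 1 ≤ n → R≤ 2 n (2 * n + 2)
theorem1 n _ = n + (2 + n) , ≤-reflexive (n+[2+n]≡2*n+2 n) , redQ₂OrBlueQₙ n
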